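{- Let $R$ be an $F$-relator. The class of all $R$-simulations (1) is closed under postcomposition with coalgebra homomorphisms iff for every relation $r\subseteq X\times Y$ and every function $f\colon A\to X$ such that $r\cdot f$ is non-empty, $Rr\cdot Ff\le R(r\cdot f)$; (2) is closed under postcomposition with converses of coalgebra homomorphisms iff for every relation $r\subseteq X\times Y$ and every function $f\colon X\to A$ such that $r\cdot f^\circ$ is non-empty, $Rr\cdot(Ff)^\circ\le R(r\cdot f^\circ)$; (3) is closed under precomposition with coalgebra homomorphisms iff for every relation $r\subseteq X\times Y$ and every function $g\colon Y\to B$ such that $g\cdot r$ is non-empty, $Fg\cdot Rr\le R(g\cdot r)$; (4) is closed under precomposition with converses of coalgebra homomorphisms iff for every relation $r\subseteq X\times Y$ and every function $g\colon B\to Y$ such that $g^\circ\cdot r$ is non-empty, $(Fg)^\circ\cdot Rr\le R(g^\circ\cdot r)$.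
   Context: $F\colon\mathbf{Set}\to\mathbf{Set}$ is a functor. Relations $r\subseteq X\times Y$ are composed applicatively ($s\cdot r=\{(x,z)\mid\exists y.\ x\,r\,y\,s\,z\}$), $r^\circ$ is the converse, functions are regarded as relations. An $F$-relator $R$ is a monotone assignment of $Rr\subseteq FX\times FY$ to each $r\subseteq X\times Y$. Given coalgebras $\alpha\colon X\to FX$, $\beta\colon Y\to FY$, $r\subseteq X\times Y$ is an $R$-simulation from $\alpha$ to $\beta$ if $r\le\beta^\circ\cdot Rr\cdot\alpha$. -}

module Defs where

open import Level using (suc; zero)
open import Data.Product using (Σ; ∃; _×_; _,_)
open import Function using (_∘_; id)
open import Relation.Binary.PropositionalEquality using (_≡_)

Rel : Set → Set → Set₁
Rel X Y = X → Y → Set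

_≤_ : ∀ {X Y} → Rel X Y → Rel X Y → Set
r ≤ s = ∀ x y → r x y → s x y

_·_ : ∀ {X Y Z} → Rel Y Z → Rel X Y → Rel X Z
(s · r) x z = ∃ λ y → r x y × s y z
infixr 9 _·_

_° : ∀ {X Y} → Rel X Y → Rel Y X
(r °) y x = r x y
infix 10 _°

⟦_⟧ : ∀ {X Y} → (X → Y) → Rel X Y
⟦ f ⟧ x y = f x ≡ y

NonEmpty : ∀ {X Y} → Rel X Y → Set
NonEmpty {X} {Y} r = Σ X λ x → Σ Y λ y → r x y

record Functor : Set₁ where
  field
    F       : Set → Set
    fmap    : ∀ {X Y} → (X → Y) → F X → F Y
    fmap-id : ∀ {X} (u : F X) → fmap id u ≡ u
    fmap-∘  : ∀ {X Y Z} (g : Y → Z) (f : X → Y) (u : F X) →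
              fmap (g ∘ f) u ≡ fmap g (fmap f u)

module _ (Fu : Functor) where
  open Functor Fu

  record Relator : Set₁ where
    field
      R    : ∀ {X Y} → Rel X Y → Rel (F X) (F Y)
      mono : ∀ {X Y} {r s : Rel X Y} → r ≤ s → R r ≤ R s

  IsHom : ∀ {X Y} → (X → F X) → (Y → F Y) → (X → Y) → Set
  IsHom α β f = ∀ x → β (f x) ≡ fmap f (α x)

  module _ (Rl : Relator) where
    open Relator Rl

    IsSim : ∀ {X Y} → (X → F X) → (Y → F Y) → Rel X Y → Set
    IsSim α β r = r ≤ ((⟦ β ⟧ °) · R r · ⟦ α ⟧)

    ClosedPostHom : Set₁
    ClosedPostHom = ∀ {A X Y} (γ : A → F A) (α : X → F X) (β : Y → F Y)
      (f : A → X) (r : Rel X Y) → IsHom γ α f → IsSim α β r → IsSim γ β (r · ⟦ f ⟧)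

    CondPostHom : Set₁
    CondPostHom = ∀ {A X Y} (r : Rel X Y) (f : A → X) →
      NonEmpty (r · ⟦ f ⟧) → (R r · ⟦ fmap f ⟧) ≤ R (r · ⟦ f ⟧)

    ClosedPostConvHom : Set₁
    ClosedPostConvHom = ∀ {A X Y} (γ : A → F A) (α : X → F X) (β : Y → F Y)
      (f : X → A) (r : Rel X Y) → IsHom α γ f → IsSim α β r → IsSim γ β (r · (⟦ f ⟧ °))

    CondPostConvHom : Set₁
    CondPostConvHom = ∀ {A X Y} (r : Rel X Y) (f : X → A) →
      NonEmpty (r · (⟦ f ⟧ °)) → (R r · (⟦ fmap f ⟧ °)) ≤ R (r · (⟦ f ⟧ °))

    ClosedPreHom : Set₁
    ClosedPreHom = ∀ {B X Y} (δ : B → F B) (α : X → F X) (β : Y → F Y)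
      (g : Y → B) (r : Rel X Y) → IsHom β δ g → IsSim α β r → IsSim α δ (⟦ g ⟧ · r)

    CondPreHom : Set₁
    CondPreHom = ∀ {B X Y} (r : Rel X Y) (g : Y → B) →
      NonEmpty (⟦ g ⟧ · r) → (⟦ fmap g ⟧ · R r) ≤ R (⟦ g ⟧ · r)

    ClosedPreConvHom : Set₁
    ClosedPreConvHom = ∀ {B X Y} (δ : B → F B) (α : X → F X) (β : Y → F Y)
      (g : B → Y) (r : Rel X Y) → IsHom δ β g → IsSim α β r → IsSim α δ ((⟦ g ⟧ °) · r)

    CondPreConvHom : Set₁
    CondPreConvHom = ∀ {B X Y} (r : Rel X Y) (g : B → Y) →
      NonEmpty ((⟦ g ⟧ °) · r) → ((⟦ fmap g ⟧ °) · R r) ≤ R ((⟦ g ⟧ °) · r)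

-- r is a simulation iff every r-related pair x, y has R r (α x) (β y).  Sufficiency of each
-- condition is then one use of the homomorphism equation.  For necessity, take the points of
-- F X, F Y, ... in the hypothesis as constant coalgebras: r is a simulation between them and
-- the given function is a homomorphism, so closure makes the composite relation a simulation
-- between constant coalgebras; any pair it relates -- this is where non-emptiness is needed --
-- then yields R of the composite at those points.
module Submission where

open import Defs
open import Data.Product using (_×_; _,_)
open import Function using (const)
open import Function.Bundles using (_⇔_; mk⇔)
open import Relation.Binary.PropositionalEquality using (refl; sym)

module _ (Fu : Functor) (Rl : Relator Fu) where
  open Functor Fu
  open Relator Rl

  IsSim⇒related : ∀ {X Y} {α : X → F X} {β : Y → F Y} {r : Rel X Y} →
                  IsSim Fu Rl α β r → ∀ {x y} → r x y → R r (α x) (β y)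
  IsSim⇒related sim {x} {y} rxy with sim x y rxy
  ... | _ , (_ , refl , related) , refl = related

  related⇒IsSim : ∀ {X Y} {α : X → F X} {β : Y → F Y} {r : Rel X Y} →
                  (∀ x y → r x y → R r (α x) (β y)) → IsSim Fu Rl α β r
  related⇒IsSim related x y rxy = _ , (_ , refl , related x y rxy) , refl

  const-IsSim : ∀ {X Y} {r : Rel X Y} {v w} → R r v w →
                IsSim Fu Rl {X} {Y} (const v) (const w) r
  const-IsSim Rvw = related⇒IsSim λ _ _ _ → Rvw

  const-IsSim⇒R : ∀ {X Y} {s : Rel X Y} {u w} →
                  IsSim Fu Rl {X} {Y} (const u) (const w) s → NonEmpty s → R s u w
  const-IsSim⇒R sim (_ , _ , sxy) = IsSim⇒related sim sxy

  closedPostHom⇔condPostHom : ClosedPostHom Fu Rl ⇔ CondPostHom Fu Rl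
  closedPostHom⇔condPostHom = mk⇔ necessary sufficient
    where
    necessary : ClosedPostHom Fu Rl → CondPostHom Fu Rl
    necessary closed r f nonEmpty u w (_ , refl , Rvw) = const-IsSim⇒R
      (closed (const u) (const (fmap f u)) (const w) f r (λ _ → refl) (const-IsSim Rvw))
      nonEmpty
    sufficient : CondPostHom Fu Rl → ClosedPostHom Fu Rl
    sufficient cond γ α β f r hom sim = related⇒IsSim λ { a y (x , refl , rxy) →
      cond r f (a , y , x , refl , rxy) (γ a) (β y)
           (α (f a) , sym (hom a) , IsSim⇒related sim rxy) }

  closedPostConvHom⇔condPostConvHom : ClosedPostConvHom Fu Rl ⇔ CondPostConvHom Fu Rl
  closedPostConvHom⇔condPostConvHom = mk⇔ necessary sufficient
    where
    necessary : ClosedPostConvHom Fu Rl → CondPostConvHom Fu Rl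
    necessary closed r f nonEmpty u w (v , fv≡u , Rvw) = const-IsSim⇒R
      (closed (const u) (const v) (const w) f r (λ _ → sym fv≡u) (const-IsSim Rvw))
      nonEmpty
    sufficient : CondPostConvHom Fu Rl → ClosedPostConvHom Fu Rl
    sufficient cond γ α β f r hom sim = related⇒IsSim λ { a y (x , refl , rxy) →
      cond r f (f x , y , x , refl , rxy) (γ (f x)) (β y)
           (α x , sym (hom x) , IsSim⇒related sim rxy) }

  closedPreHom⇔condPreHom : ClosedPreHom Fu Rl ⇔ CondPreHom Fu Rl
  closedPreHom⇔condPreHom = mk⇔ necessary sufficient
    where
    necessary : ClosedPreHom Fu Rl → CondPreHom Fu Rl
    necessary closed r g nonEmpty u w (v , Ruv , gv≡w) = const-IsSim⇒R
      (closed (const w) (const u) (const v) g r (λ _ → sym gv≡w) (const-IsSim Ruv))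
      nonEmpty
    sufficient : CondPreHom Fu Rl → ClosedPreHom Fu Rl
    sufficient cond δ α β g r hom sim = related⇒IsSim λ { x b (y , rxy , refl) →
      cond r g (x , g y , y , rxy , refl) (α x) (δ (g y))
           (β y , IsSim⇒related sim rxy , sym (hom y)) }

  closedPreConvHom⇔condPreConvHom : ClosedPreConvHom Fu Rl ⇔ CondPreConvHom Fu Rl
  closedPreConvHom⇔condPreConvHom = mk⇔ necessary sufficient
    where
    necessary : ClosedPreConvHom Fu Rl → CondPreConvHom Fu Rl
    necessary closed r g nonEmpty u w (v , Ruv , gw≡v) = const-IsSim⇒R
      (closed (const w) (const u) (const v) g r (λ _ → sym gw≡v) (const-IsSim Ruv))
      nonEmpty
    sufficient : CondPreConvHom Fu Rl → ClosedPreConvHom Fu Rl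
    sufficient cond δ α β g r hom sim = related⇒IsSim λ { x b (y , rxy , refl) →
      cond r g (x , b , g b , rxy , refl) (α x) (δ b)
           (β (g b) , IsSim⇒related sim rxy , sym (hom b)) }

theorem4 : (Fu : Functor) (Rl : Relator Fu) →
    (ClosedPostHom Fu Rl ⇔ CondPostHom Fu Rl) ×
    (ClosedPostConvHom Fu Rl ⇔ CondPostConvHom Fu Rl) ×
    (ClosedPreHom Fu Rl ⇔ CondPreHom Fu Rl) ×
    (ClosedPreConvHom Fu Rl ⇔ CondPreConvHom Fu Rl)
theorem4 Fu Rl =
  closedPostHom⇔condPostHom Fu Rl ,
  closedPostConvHom⇔condPostConvHom Fu Rl ,
  closedPreHom⇔condPreHom Fu Rl ,
  closedPreConvHom⇔condPreConvHom Fu Rl
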